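{- Let $\lambda\in\mathbb{R}$. For all integers $m,n\ge 0$ and every real $x$, \[ \sum_{k=0}^{m}S_{2,\lambda}(m,k)\,(k)_{n,\lambda}\,x^{k} =\sum_{k=0}^{n}\sum_{j=0}^{n-k}\binom{n}{k}\binom{n-k}{j}\mathrm{Bel}_{m+k,\lambda}(x)\,\mathrm{Bel}_{n-k-j,\lambda}(-x)\,(m\lambda)_{j,\lambda}. \]
   Context: For $\lambda\in\mathbb{R}$, $(x)_{0,\lambda}=1$ and $(x)_{n,\lambda}=x(x-\lambda)\cdots(x-(n-1)\lambda)$ for $n\ge1$; $(x)_0=1$ and $(x)_n=x(x-1)\cdots(x-n+1)$. The degenerate Stirling numbers of the second kind $S_{2,\lambda}(n,k)$ are defined by $(x)_{n,\lambda}=\sum_{k=0}^{n}S_{2,\lambda}(n,k)(x)_{k}$. The degenerate exponential is $e_\lambda(t)=\sum_{k\ge0}(1)_{k,\lambda}t^k/k!$, and the degenerate Bell polynomials are defined by $e^{x(e_{\lambda}(t)-1)}=\sum_{n=0}^{\infty}\mathrm{Bel}_{n,\lambda}(x)\frac{t^{n}}{n!}$ (equivalently $\mathrm{Bel}_{n,\lambda}(x)=\sum_{k=0}^nS_{2,\lambda}(n,k)x^k$). -}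

module Defs where

open import Level using (Level)
open import Data.Nat as ℕ using (ℕ; zero; suc)
open import Data.Nat.Combinatorics using (_C_)
open import Algebra.Bundles using (CommutativeRing)

-- All notions are defined over an arbitrary commutative ring R
-- (the paper works over ℝ).
module _ {c ℓ : Level} (R : CommutativeRing c ℓ) where
  open CommutativeRing R using (Carrier; _+_; _*_; _-_; 0#; 1#)

  ⟦_⟧ : ℕ → Carrier
  ⟦ zero ⟧  = 0#
  ⟦ suc n ⟧ = 1# + ⟦ n ⟧

  pow : Carrier → ℕ → Carrier
  pow x zero    = 1#
  pow x (suc n) = pow x n * x

  sumTo : ℕ → (ℕ → Carrier) → Carrier
  sumTo zero    f = f zero
  sumTo (suc n) f = sumTo n f + f (suc n)

  dfall : Carrier → Carrier → ℕ → Carrier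
  dfall λ' x zero    = 1#
  dfall λ' x (suc n) = dfall λ' x n * (x - ⟦ n ⟧ * λ')

  -- degenerate Stirling numbers of the second kind S_{2,λ}(n,k), i.e. the
  -- coefficients in (x)_{n,λ} = Σ_k S_{2,λ}(n,k) (x)_k, computed by the
  -- recurrence forced by (x)_{n+1,λ} = (x)_{n,λ} (x - nλ) and
  -- x (x)_k = (x)_{k+1} + k (x)_k :
  --   S(n+1,k) = S(n,k-1) + (k - nλ) S(n,k),  S(0,0)=1, S(0,k+1)=0.
  S2 : Carrier → ℕ → ℕ → Carrier
  S2 λ' zero    zero    = 1#
  S2 λ' zero    (suc k) = 0#
  S2 λ' (suc n) zero    = (0# - ⟦ n ⟧ * λ') * S2 λ' n zero
  S2 λ' (suc n) (suc k) = S2 λ' n k + (⟦ suc k ⟧ - ⟦ n ⟧ * λ') * S2 λ' n (suc k)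

  Bel : Carrier → ℕ → Carrier → Carrier
  Bel λ' n x = sumTo n (λ k → S2 λ' n k * pow x k)

  binom : ℕ → ℕ → Carrier
  binom n k = ⟦ n C k ⟧

{-# OPTIONS --safe #-}

-- Read a sequence a as the exponential generating function Σ aₙ tⁿ/n!. Binomial convolution ⋆ is then the
-- product, D is d/dt, and θ a n = a (n+1) + nλ·a n is the derivation (1 + λt) d/dt. A solution of
-- θ g = s·g + h is determined by g 0; this gives θ (eλ a) = a·eλ a for eλ a = ((a)ₙ,λ)ₙ = (1 + λt)^(a/λ),
-- eλ (a + b) = eλ a ⋆ eλ b, θ Bₓ = x·(e ⋆ Bₓ) for the Bell sequence Bₓ = (Bel_{n,λ}(x))ₙ and e = eλ 1 = e_λ(t),
-- and Bₓ ⋆ B₋ₓ = δ. As sequences in n, both sides of the identity are δ for m = 0 and satisfy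
-- Xₘ₊₁ = x·(e ⋆ Xₘ) + θ Xₘ − mλ·Xₘ: the left side by the triangular recurrence of S_{2,λ}, the right side,
-- which is Dᵐ Bₓ ⋆ eλ (mλ) ⋆ B₋ₓ, because θ is a derivation, θ (Dᵐ Bₓ) = Dᵐ⁺¹ Bₓ ⋆ eλ λ and
-- eλ ((m+1)λ) = eλ λ ⋆ eλ (mλ).
module Submission where

open import Level using (Level)
open import Algebra.Bundles using (CommutativeRing; CommutativeMonoid)
import Algebra.Construct.Pointwise
import Algebra.Solver.Ring.AlmostCommutativeRing as ACR
open import Data.Integer as ℤ using (ℤ; +_; -[1+_]; _⊖_; _◃_; sign; ∣_∣; 0ℤ; 1ℤ)
import Data.Integer.Properties as ℤP
open import Data.Maybe using (Maybe; map)
open import Data.Nat as ℕ using (ℕ; zero; suc; _∸_)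
open import Data.Nat.Combinatorics using (_C_; nCk+nC[k+1]≡[n+1]C[k+1]; k>n⇒nCk≡0)
import Data.Nat.Properties as ℕP
open import Data.Product using (_,_)
open import Data.Sign as Sign using (Sign)
open import Data.Sum using (inj₁; inj₂)
open import Relation.Binary.Bundles using (Setoid)
open import Relation.Binary.Consequences using (dec⇒weaklyDec)
import Relation.Binary.PropositionalEquality as P
import Relation.Binary.Reasoning.Setoid as SetoidReasoning

open import Defs

module IntegerCoefficients {c ℓ : Level} (R : CommutativeRing c ℓ) where
  open CommutativeRing R
  open import Algebra.Properties.Ring ring using (-‿involutive; -0#≈0#; -‿distribˡ-*; -‿distribʳ-*)
  open import Algebra.Properties.Group +-group using (//-rightDividesʳ)
  open import Algebra.Properties.AbelianGroup +-abelianGroup using (⁻¹-∙-comm)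
  open import Algebra.Properties.CommutativeSemigroup +-commutativeSemigroup using (x∙yz≈y∙xz)
  open import Algebra.Properties.Semiring.Mult.TCOptimised semiring using (_×_; 1+×; ×-homo-+; ×1-homo-*)
  open SetoidReasoning setoid

  -- With the optimised multiple, 1 × 1# reduces to 1#, so the solver constants con 0ℤ and con 1ℤ are literally 0# and 1#.
  fromℤ : ℤ → Carrier
  fromℤ (+ n)    = n × 1#
  fromℤ -[1+ n ] = - (suc n × 1#)

  fromℤ-⊖-+ : ∀ m n → fromℤ (m ⊖ n) + n × 1# ≈ m × 1#
  fromℤ-⊖-+ m zero = begin
    fromℤ (m ⊖ 0) + 0# ≈⟨ +-identityʳ _ ⟩
    fromℤ (m ⊖ 0)      ≡⟨ P.cong fromℤ (ℤP.⊖-≥ {m} ℕ.z≤n) ⟩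
    m × 1#             ∎
  fromℤ-⊖-+ zero (suc n) = begin
    fromℤ (0 ⊖ suc n) + suc n × 1#   ≡⟨ P.cong (λ i → fromℤ i + suc n × 1#) (ℤP.⊖-≤ {0} {suc n} ℕ.z≤n) ⟩
    - (suc n × 1#) + suc n × 1#      ≈⟨ -‿inverseˡ _ ⟩
    0#                               ∎
  fromℤ-⊖-+ (suc m) (suc n) = begin
    fromℤ (suc m ⊖ suc n) + suc n × 1# ≡⟨ P.cong (λ i → fromℤ i + suc n × 1#) (ℤP.[1+m]⊖[1+n]≡m⊖n m n) ⟩
    fromℤ (m ⊖ n) + suc n × 1#         ≈⟨ +-congˡ (1+× n 1#) ⟩
    fromℤ (m ⊖ n) + (1# + n × 1#)      ≈⟨ x∙yz≈y∙xz _ _ _ ⟩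
    1# + (fromℤ (m ⊖ n) + n × 1#)      ≈⟨ +-congˡ (fromℤ-⊖-+ m n) ⟩
    1# + m × 1#                        ≈⟨ 1+× m 1# ⟨
    suc m × 1#                         ∎

  fromℤ-⊖ : ∀ m n → fromℤ (m ⊖ n) ≈ m × 1# - n × 1#
  fromℤ-⊖ m n = trans (sym (//-rightDividesʳ (n × 1#) _)) (+-congʳ (fromℤ-⊖-+ m n))

  fromℤ-+ : ∀ i j → fromℤ (i ℤ.+ j) ≈ fromℤ i + fromℤ j
  fromℤ-+ -[1+ m ] -[1+ n ] = begin
    - (suc (suc (m ℕ.+ n)) × 1#)         ≡⟨ P.cong (λ k → - (suc k × 1#)) (ℕP.+-suc m n) ⟨
    - ((suc m ℕ.+ suc n) × 1#)           ≈⟨ -‿cong (×-homo-+ 1# (suc m) (suc n)) ⟩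
    - (suc m × 1# + suc n × 1#)          ≈⟨ ⁻¹-∙-comm _ _ ⟨
    - (suc m × 1#) + - (suc n × 1#)      ∎
  fromℤ-+ -[1+ m ] (+ n)    = trans (fromℤ-⊖ n (suc m)) (+-comm _ _)
  fromℤ-+ (+ m)    -[1+ n ] = fromℤ-⊖ m (suc n)
  fromℤ-+ (+ m)    (+ n)    = ×-homo-+ 1# m n

  fromℤ-neg : ∀ i → fromℤ (ℤ.- i) ≈ - fromℤ i
  fromℤ-neg -[1+ n ]  = sym (-‿involutive _)
  fromℤ-neg (+ zero)  = sym -0#≈0#
  fromℤ-neg (+ suc n) = refl

  signed : Sign → Carrier → Carrier
  signed Sign.+ a = a
  signed Sign.- a = - a

  signed-cong : ∀ s {a b} → a ≈ b → signed s a ≈ signed s b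
  signed-cong Sign.+ a≈b = a≈b
  signed-cong Sign.- a≈b = -‿cong a≈b

  signed-* : ∀ s t a b → signed s a * signed t b ≈ signed (s Sign.* t) (a * b)
  signed-* Sign.+ Sign.+ a b = refl
  signed-* Sign.+ Sign.- a b = sym (-‿distribʳ-* a b)
  signed-* Sign.- Sign.+ a b = sym (-‿distribˡ-* a b)
  signed-* Sign.- Sign.- a b = begin
    - a * - b     ≈⟨ -‿distribˡ-* a (- b) ⟨
    - (a * - b)   ≈⟨ -‿cong (-‿distribʳ-* a b) ⟨
    - - (a * b)   ≈⟨ -‿involutive _ ⟩
    a * b         ∎

  fromℤ-◃ : ∀ s n → fromℤ (s ◃ n) ≈ signed s (n × 1#)
  fromℤ-◃ Sign.+ zero    = refl
  fromℤ-◃ Sign.- zero    = sym -0#≈0#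
  fromℤ-◃ Sign.+ (suc n) = refl
  fromℤ-◃ Sign.- (suc n) = refl

  fromℤ-signAbs : ∀ i → signed (sign i) (∣ i ∣ × 1#) ≈ fromℤ i
  fromℤ-signAbs i = trans (sym (fromℤ-◃ (sign i) ∣ i ∣)) (reflexive (P.cong fromℤ (ℤP.◃-inverse i)))

  fromℤ-* : ∀ i j → fromℤ (i ℤ.* j) ≈ fromℤ i * fromℤ j
  fromℤ-* i j = begin
    fromℤ (sign i Sign.* sign j ◃ ∣ i ∣ ℕ.* ∣ j ∣)               ≈⟨ fromℤ-◃ (sign i Sign.* sign j) (∣ i ∣ ℕ.* ∣ j ∣) ⟩
    signed (sign i Sign.* sign j) ((∣ i ∣ ℕ.* ∣ j ∣) × 1#)       ≈⟨ signed-cong (sign i Sign.* sign j) (×1-homo-* ∣ i ∣ ∣ j ∣) ⟩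
    signed (sign i Sign.* sign j) ((∣ i ∣ × 1#) * (∣ j ∣ × 1#))  ≈⟨ signed-* (sign i) (sign j) _ _ ⟨
    signed (sign i) (∣ i ∣ × 1#) * signed (sign j) (∣ j ∣ × 1#)  ≈⟨ *-cong (fromℤ-signAbs i) (fromℤ-signAbs j) ⟩
    fromℤ i * fromℤ j                                            ∎

  fromℤ-homomorphism : ℤ.+-*-rawRing ACR.-Raw-AlmostCommutative⟶ ACR.fromCommutativeRing R
  fromℤ-homomorphism = record
    { ⟦_⟧ = fromℤ ; +-homo = fromℤ-+ ; *-homo = fromℤ-* ; -‿homo = fromℤ-neg ; 0-homo = refl ; 1-homo = refl }

  fromℤ-≟ : ∀ i j → Maybe (fromℤ i ≈ fromℤ j)
  fromℤ-≟ i j = map (λ { P.refl → refl }) (dec⇒weaklyDec ℤ._≟_ i j)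

  open import Algebra.Solver.Ring ℤ.+-*-rawRing (ACR.fromCommutativeRing R) fromℤ-homomorphism fromℤ-≟ public

module FiniteSums {c ℓ : Level} (R : CommutativeRing c ℓ) where
  open CommutativeRing R
  open import Algebra.Properties.CommutativeSemigroup +-commutativeSemigroup using (interchange)

  ∑ : ℕ → (ℕ → Carrier) → Carrier
  ∑ = sumTo R

  syntax ∑ n (λ k → e) = ∑[ k ≤ n ] e

  ∑-cong≤ : ∀ n {f g : ℕ → Carrier} → (∀ k → k ℕ.≤ n → f k ≈ g k) → ∑ n f ≈ ∑ n g
  ∑-cong≤ zero    f≈g = f≈g 0 ℕ.z≤n
  ∑-cong≤ (suc n) f≈g = +-cong (∑-cong≤ n (λ k k≤n → f≈g k (ℕP.m≤n⇒m≤1+n k≤n))) (f≈g (suc n) ℕP.≤-refl)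

  ∑-cong : ∀ n {f g : ℕ → Carrier} → (∀ k → f k ≈ g k) → ∑ n f ≈ ∑ n g
  ∑-cong n f≈g = ∑-cong≤ n (λ k _ → f≈g k)

  ∑-distrib-+ : ∀ n (f g : ℕ → Carrier) → ∑[ k ≤ n ] (f k + g k) ≈ ∑ n f + ∑ n g
  ∑-distrib-+ zero    f g = refl
  ∑-distrib-+ (suc n) f g = trans (+-congʳ (∑-distrib-+ n f g)) (interchange _ _ _ _)

  *-distribˡ-∑ : ∀ n a (f : ℕ → Carrier) → a * ∑ n f ≈ ∑[ k ≤ n ] (a * f k)
  *-distribˡ-∑ zero    a f = refl
  *-distribˡ-∑ (suc n) a f = trans (distribˡ a _ _) (+-congʳ (*-distribˡ-∑ n a f))

  *-distribʳ-∑ : ∀ n a (f : ℕ → Carrier) → ∑ n f * a ≈ ∑[ k ≤ n ] (f k * a)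
  *-distribʳ-∑ zero    a f = refl
  *-distribʳ-∑ (suc n) a f = trans (distribʳ a _ _) (+-congʳ (*-distribʳ-∑ n a f))

  ∑-zero : ∀ n → ∑[ k ≤ n ] 0# ≈ 0#
  ∑-zero zero    = refl
  ∑-zero (suc n) = trans (+-identityʳ _) (∑-zero n)

  ∑-head : ∀ n (f : ℕ → Carrier) → ∑ (suc n) f ≈ f 0 + ∑[ k ≤ n ] f (suc k)
  ∑-head zero    f = refl
  ∑-head (suc n) f = trans (+-congʳ (∑-head n f)) (+-assoc _ _ _)

  ∑-comm : ∀ n m (f : ℕ → ℕ → Carrier) → ∑[ i ≤ n ] ∑[ k ≤ m ] f i k ≈ ∑[ k ≤ m ] ∑[ i ≤ n ] f i k
  ∑-comm zero    m f = refl
  ∑-comm (suc n) m f = trans (+-congʳ (∑-comm n m f)) (sym (∑-distrib-+ m _ _))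

  ∑-extend : ∀ {n N} (f : ℕ → Carrier) → n ℕ.≤ N → (∀ k → n ℕ.< k → f k ≈ 0#) → ∑ N f ≈ ∑ n f
  ∑-extend {n} f n≤N f≈0 = go (ℕP.≤⇒≤′ n≤N)
    where
    go : ∀ {N} → n ℕ.≤′ N → ∑ N f ≈ ∑ n f
    go ℕ.≤′-refl        = refl
    go (ℕ.≤′-step n≤′N) = trans (+-cong (go n≤′N) (f≈0 _ (ℕ.s≤s (ℕP.≤′⇒≤ n≤′N)))) (+-identityʳ _)

module Convolution {c ℓ : Level} (R : CommutativeRing c ℓ) where
  open CommutativeRing R
  open FiniteSums R
  open IntegerCoefficients R using (solve; _:=_; _:+_; _:*_)
  open import Algebra.Properties.CommutativeSemigroup +-commutativeSemigroup using (x∙yz≈y∙xz)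
  open SetoidReasoning setoid

  Seq : Set c
  Seq = ℕ → Carrier

  infix 4 _≋_
  _≋_ : Seq → Seq → Set ℓ
  a ≋ b = ∀ n → a n ≈ b n

  ≋-setoid : Setoid c ℓ
  ≋-setoid = record { Carrier = Seq ; _≈_ = _≋_ ; isEquivalence = Algebra.Construct.Pointwise.isEquivalence ℕ isEquivalence }

  open Setoid ≋-setoid public using () renaming (refl to ≋-refl; sym to ≋-sym; trans to ≋-trans)
  module ≋-Reasoning = SetoidReasoning ≋-setoid
  module ≈-Reasoning = SetoidReasoning setoid

  infixl 7 _⋆_
  infixl 6 _⊞_
  infixr 8 _·_

  _⋆_ : Seq → Seq → Seq
  (a ⋆ b) n = ∑[ k ≤ n ] (binom R n k * a k * b (n ∸ k))

  _⊞_ : Seq → Seq → Seq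
  (a ⊞ b) n = a n + b n

  _·_ : Carrier → Seq → Seq
  (s · a) n = s * a n

  D : Seq → Seq
  D a n = a (suc n)

  δ : Seq
  δ zero    = 1#
  δ (suc n) = 0#

  𝟘 : Seq
  𝟘 _ = 0#

  fromℕ : ℕ → Carrier
  fromℕ = ⟦_⟧ R

  fromℕ-1-identityˡ : ∀ a → fromℕ 1 * a ≈ a
  fromℕ-1-identityˡ a = trans (*-congʳ (+-identityʳ 1#)) (*-identityˡ a)

  fromℕ-+ : ∀ m n → fromℕ (m ℕ.+ n) ≈ fromℕ m + fromℕ n
  fromℕ-+ zero    n = sym (+-identityˡ _)
  fromℕ-+ (suc m) n = trans (+-congˡ (fromℕ-+ m n)) (sym (+-assoc _ _ _))

  binom-pascal : ∀ n k → binom R (suc n) (suc k) ≈ binom R n k + binom R n (suc k)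
  binom-pascal n k = trans (reflexive (P.cong fromℕ (P.sym (nCk+nC[k+1]≡[n+1]C[k+1] n k)))) (fromℕ-+ (n C k) (n C suc k))


  binom-vanish : ∀ {n k} → n ℕ.< k → binom R n k ≈ 0#
  binom-vanish n<k = reflexive (P.cong fromℕ (k>n⇒nCk≡0 n<k))

  ⊞-cong : ∀ {a a′ b b′} → a ≋ a′ → b ≋ b′ → a ⊞ b ≋ a′ ⊞ b′
  ⊞-cong a≋a′ b≋b′ n = +-cong (a≋a′ n) (b≋b′ n)

  ·-congʳ : ∀ s {a b} → a ≋ b → s · a ≋ s · b
  ·-congʳ s a≋b n = *-congˡ (a≋b n)

  ⋆-cong : ∀ {a a′ b b′} → a ≋ a′ → b ≋ b′ → a ⋆ b ≋ a′ ⋆ b′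
  ⋆-cong a≋a′ b≋b′ n = ∑-cong n (λ k → *-cong (*-congˡ (a≋a′ k)) (b≋b′ (n ∸ k)))

  ⋆-congˡ : ∀ {a a′} b → a ≋ a′ → a ⋆ b ≋ a′ ⋆ b
  ⋆-congˡ b a≋a′ = ⋆-cong {b = b} a≋a′ (λ _ → refl)

  ⋆-congʳ : ∀ a {b b′} → b ≋ b′ → a ⋆ b ≋ a ⋆ b′
  ⋆-congʳ a b≋b′ = ⋆-cong {a = a} (λ _ → refl) b≋b′

  ⋆-head : ∀ a b → (a ⋆ b) 0 ≈ a 0 * b 0
  ⋆-head a b = *-congʳ (fromℕ-1-identityˡ (a 0))

  ⋆-distribˡ : ∀ a b c → a ⋆ (b ⊞ c) ≋ a ⋆ b ⊞ a ⋆ c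
  ⋆-distribˡ a b c n = trans (∑-cong n (λ k → distribˡ _ _ _)) (∑-distrib-+ n _ _)

  ⋆-distribʳ : ∀ a b c → (a ⊞ b) ⋆ c ≋ a ⋆ c ⊞ b ⋆ c
  ⋆-distribʳ a b c n = trans (∑-cong n (λ k → solve 4 (λ β x y z → β :* (x :+ y) :* z := β :* x :* z :+ β :* y :* z)
    refl (binom R n k) (a k) (b k) (c (n ∸ k)))) (∑-distrib-+ n _ _)

  ⋆-scaleˡ : ∀ s a b → (s · a) ⋆ b ≋ s · (a ⋆ b)
  ⋆-scaleˡ s a b n = sym (trans (*-distribˡ-∑ n s _) (∑-cong n (λ k → solve 4 (λ s β x y → s :* (β :* x :* y) := β :* (s :* x) :* y)
    refl s (binom R n k) (a k) (b (n ∸ k)))))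

  ⋆-scaleʳ : ∀ s a b → a ⋆ (s · b) ≋ s · (a ⋆ b)
  ⋆-scaleʳ s a b n = sym (trans (*-distribˡ-∑ n s _) (∑-cong n (λ k → solve 4 (λ s β x y → s :* (β :* x :* y) := β :* x :* (s :* y))
    refl s (binom R n k) (a k) (b (n ∸ k)))))

  ⋆-zeroˡ : ∀ a → 𝟘 ⋆ a ≋ 𝟘
  ⋆-zeroˡ a n = trans (∑-cong n (λ k → trans (*-congʳ (zeroʳ _)) (zeroˡ _))) (∑-zero n)

  D-leibniz : ∀ a b → D (a ⋆ b) ≋ D a ⋆ b ⊞ a ⋆ D b
  D-leibniz a b n = begin
    (a ⋆ b) (suc n)                                  ≈⟨ ∑-head n _ ⟩
    binom R (suc n) 0 * a 0 * b (suc n) + ∑[ k ≤ n ] (binom R (suc n) (suc k) * a (suc k) * b (n ∸ k))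
      ≈⟨ +-cong (*-congʳ (fromℕ-1-identityˡ (a 0))) (∑-cong n pascal) ⟩
    a 0 * b (suc n) + ∑[ k ≤ n ] (X k + Y k)         ≈⟨ +-congˡ (∑-distrib-+ n X Y) ⟩
    a 0 * b (suc n) + (∑ n X + ∑ n Y)                ≈⟨ x∙yz≈y∙xz _ _ _ ⟩
    ∑ n X + (a 0 * b (suc n) + ∑ n Y)                ≈⟨ +-congˡ a⋆Db-unfold ⟨
    (D a ⋆ b) n + (a ⋆ D b) n                        ∎
    where
    X Y : ℕ → Carrier
    X k = binom R n k * a (suc k) * b (n ∸ k)
    Y k = binom R n (suc k) * a (suc k) * b (n ∸ k)
    pascal : ∀ k → binom R (suc n) (suc k) * a (suc k) * b (n ∸ k) ≈ X k + Y k
    pascal k = trans (*-congʳ (*-congʳ (binom-pascal n k)))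
      (solve 4 (λ β γ x y → (β :+ γ) :* x :* y := β :* x :* y :+ γ :* x :* y) refl _ _ _ _)
    term : ℕ → Carrier
    term k = binom R n k * a k * b (suc n ∸ k)
    a⋆Db-unfold : (a ⋆ D b) n ≈ a 0 * b (suc n) + ∑ n Y
    a⋆Db-unfold = begin
      (a ⋆ D b) n                        ≈⟨ ∑-cong≤ n (λ k k≤n → *-congˡ (reflexive (P.cong b (P.sym (ℕP.+-∸-assoc 1 k≤n))))) ⟩
      ∑ n term                           ≈⟨ ∑-extend term (ℕP.n≤1+n n) (λ k n<k → trans (*-congʳ (trans (*-congʳ (binom-vanish n<k)) (zeroˡ _))) (zeroˡ _)) ⟨
      ∑ (suc n) term                     ≈⟨ ∑-head n term ⟩
      term 0 + ∑ n Y                     ≈⟨ +-congʳ (*-congʳ (fromℕ-1-identityˡ (a 0))) ⟩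
      a 0 * b (suc n) + ∑ n Y            ∎

  ⋆-comm : ∀ a b → a ⋆ b ≋ b ⋆ a
  ⋆-comm a b zero    = trans (⋆-head a b) (trans (*-comm _ _) (sym (⋆-head b a)))
  ⋆-comm a b (suc n) = begin
    D (a ⋆ b) n                ≈⟨ D-leibniz a b n ⟩
    (D a ⋆ b) n + (a ⋆ D b) n  ≈⟨ +-cong (⋆-comm (D a) b n) (⋆-comm a (D b) n) ⟩
    (b ⋆ D a) n + (D b ⋆ a) n  ≈⟨ +-comm _ _ ⟩
    (D b ⋆ a) n + (b ⋆ D a) n  ≈⟨ D-leibniz b a n ⟨
    D (b ⋆ a) n                ∎

  ⋆-assoc : ∀ a b c → (a ⋆ b) ⋆ c ≋ a ⋆ (b ⋆ c)
  ⋆-assoc a b c zero = begin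
    ((a ⋆ b) ⋆ c) 0      ≈⟨ trans (⋆-head (a ⋆ b) c) (*-congʳ (⋆-head a b)) ⟩
    a 0 * b 0 * c 0      ≈⟨ *-assoc _ _ _ ⟩
    a 0 * (b 0 * c 0)    ≈⟨ trans (⋆-head a (b ⋆ c)) (*-congˡ (⋆-head b c)) ⟨
    (a ⋆ (b ⋆ c)) 0      ∎
  ⋆-assoc a b c (suc n) = begin
    D ((a ⋆ b) ⋆ c) n
      ≈⟨ D-leibniz (a ⋆ b) c n ⟩
    (D (a ⋆ b) ⋆ c) n + ((a ⋆ b) ⋆ D c) n
      ≈⟨ +-congʳ (trans (⋆-congˡ c (D-leibniz a b) n) (⋆-distribʳ (D a ⋆ b) (a ⋆ D b) c n)) ⟩
    ((D a ⋆ b) ⋆ c) n + ((a ⋆ D b) ⋆ c) n + ((a ⋆ b) ⋆ D c) n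
      ≈⟨ +-cong (+-cong (⋆-assoc (D a) b c n) (⋆-assoc a (D b) c n)) (⋆-assoc a b (D c) n) ⟩
    (D a ⋆ (b ⋆ c)) n + (a ⋆ (D b ⋆ c)) n + (a ⋆ (b ⋆ D c)) n
      ≈⟨ +-assoc _ _ _ ⟩
    (D a ⋆ (b ⋆ c)) n + ((a ⋆ (D b ⋆ c)) n + (a ⋆ (b ⋆ D c)) n)
      ≈⟨ +-congˡ (trans (⋆-congʳ a (D-leibniz b c) n) (⋆-distribˡ a (D b ⋆ c) (b ⋆ D c) n)) ⟨
    (D a ⋆ (b ⋆ c)) n + (a ⋆ D (b ⋆ c)) n
      ≈⟨ D-leibniz a (b ⋆ c) n ⟨
    D (a ⋆ (b ⋆ c)) n
      ∎

  ⋆-identityˡ : ∀ a → δ ⋆ a ≋ a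
  ⋆-identityˡ a zero    = trans (⋆-head δ a) (*-identityˡ _)
  ⋆-identityˡ a (suc n) = begin
    D (δ ⋆ a) n                ≈⟨ D-leibniz δ a n ⟩
    (𝟘 ⋆ a) n + (δ ⋆ D a) n    ≈⟨ +-cong (⋆-zeroˡ a n) (⋆-identityˡ (D a) n) ⟩
    0# + a (suc n)             ≈⟨ +-identityˡ _ ⟩
    a (suc n)                  ∎

  ⋆-identityʳ : ∀ a → a ⋆ δ ≋ a
  ⋆-identityʳ a = ≋-trans (⋆-comm a δ) (⋆-identityˡ a)

  ⋆-commutativeMonoid : CommutativeMonoid c ℓ
  ⋆-commutativeMonoid = record
    { _≈_ = _≋_ ; _∙_ = _⋆_ ; ε = δ
    ; isCommutativeMonoid = record
      { isMonoid = record
        { isSemigroup = record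
          { isMagma = record { isEquivalence = Setoid.isEquivalence ≋-setoid ; ∙-cong = ⋆-cong }
          ; assoc = ⋆-assoc }
        ; identity = ⋆-identityˡ , ⋆-identityʳ }
      ; comm = ⋆-comm } }

  ⋆-cong-upto : ∀ a {b b′} n → (∀ j → j ℕ.≤ n → b j ≈ b′ j) → (a ⋆ b) n ≈ (a ⋆ b′) n
  ⋆-cong-upto a n b≈b′ = ∑-cong n (λ i → *-congˡ (b≈b′ (n ∸ i) (ℕP.m∸n≤m n i)))

  linComb : ℕ → (ℕ → Carrier) → (ℕ → Seq) → Seq
  linComb m w u n = ∑[ k ≤ m ] (u k n * w k)

  linComb-cong : ∀ m w {u v} → (∀ k → u k ≋ v k) → linComb m w u ≋ linComb m w v
  linComb-cong m w u≋v n = ∑-cong m (λ k → *-congʳ (u≋v k n))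

  linComb-⊞ : ∀ m w u v → linComb m w (λ k → u k ⊞ v k) ≋ linComb m w u ⊞ linComb m w v
  linComb-⊞ m w u v n = trans (∑-cong m (λ k → distribʳ (w k) _ _)) (∑-distrib-+ m _ _)

  linComb-· : ∀ m w s u → linComb m w (λ k → s · u k) ≋ s · linComb m w u
  linComb-· m w s u n = trans (∑-cong m (λ k → *-assoc s _ _)) (sym (*-distribˡ-∑ m s _))

  ⋆-linComb : ∀ a m w u → a ⋆ linComb m w u ≋ linComb m w (λ k → a ⋆ u k)
  ⋆-linComb a m w u n = begin
    ∑[ i ≤ n ] (binom R n i * a i * ∑[ k ≤ m ] (u k (n ∸ i) * w k))   ≈⟨ ∑-cong n (λ i → *-distribˡ-∑ m _ _) ⟩
    ∑[ i ≤ n ] ∑[ k ≤ m ] (binom R n i * a i * (u k (n ∸ i) * w k))   ≈⟨ ∑-comm n m _ ⟩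
    ∑[ k ≤ m ] ∑[ i ≤ n ] (binom R n i * a i * (u k (n ∸ i) * w k))   ≈⟨ ∑-cong m (λ k → ∑-cong n (λ i → sym (*-assoc _ _ _))) ⟩
    ∑[ k ≤ m ] ∑[ i ≤ n ] (binom R n i * a i * u k (n ∸ i) * w k)     ≈⟨ ∑-cong m (λ k → *-distribʳ-∑ n (w k) _) ⟨
    linComb m w (λ k → a ⋆ u k) n                                     ∎

module DegenerateDerivative {c ℓ : Level} (R : CommutativeRing c ℓ) (λ' : CommutativeRing.Carrier R) where
  open CommutativeRing R
  open Convolution R
  open FiniteSums R
  open IntegerCoefficients R using (solve; _:=_; _:+_; _:*_; _:-_; con)
  open import Algebra.Properties.CommutativeSemigroup (CommutativeMonoid.commutativeSemigroup ⋆-commutativeMonoid)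
    using () renaming (xy∙z≈xz∙y to ⋆-swapʳ)

  θ : Seq → Seq
  θ a n = a (suc n) + (fromℕ n * λ') * a n

  eλ : Carrier → Seq
  eλ a n = dfall R λ' a n

  θ-cong : ∀ {a b} → a ≋ b → θ a ≋ θ b
  θ-cong a≋b n = +-cong (a≋b (suc n)) (*-congˡ (a≋b n))

  θ-⊞ : ∀ a b → θ (a ⊞ b) ≋ θ a ⊞ θ b
  θ-⊞ a b n = solve 5 (λ a′ b′ ν a b → a′ :+ b′ :+ ν :* (a :+ b) := a′ :+ ν :* a :+ (b′ :+ ν :* b))
    refl (a (suc n)) (b (suc n)) (fromℕ n * λ') (a n) (b n)

  θ-· : ∀ s a → θ (s · a) ≋ s · θ a
  θ-· s a n = solve 4 (λ s a′ ν a → s :* a′ :+ ν :* (s :* a) := s :* (a′ :+ ν :* a)) refl s (a (suc n)) (fromℕ n * λ') (a n)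

  eλ-cong : ∀ {a b} → a ≈ b → eλ a ≋ eλ b
  eλ-cong a≈b zero    = refl
  eλ-cong a≈b (suc n) = *-cong (eλ-cong a≈b n) (+-congʳ a≈b)

  θ-eλ : ∀ a → θ (eλ a) ≋ a · eλ a
  θ-eλ a n = solve 3 (λ e a ν → e :* (a :- ν) :+ ν :* e := a :* e) refl (eλ a n) a (fromℕ n * λ')

  eλ-vanish : ∀ j k → j ℕ.≤ k → eλ (fromℕ j * λ') (suc k) ≈ 0#
  eλ-vanish j k j≤k with ℕP.m≤n⇒m<n∨m≡n j≤k
  ... | inj₂ P.refl              = trans (*-congˡ (-‿inverseʳ _)) (zeroʳ _)
  ... | inj₁ (ℕ.s≤s j≤k-1)       = trans (*-congʳ (eλ-vanish j _ j≤k-1)) (zeroˡ _)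

  eλ-zero : eλ 0# ≋ δ
  eλ-zero zero    = refl
  eλ-zero (suc k) = trans (eλ-cong (sym (zeroˡ λ')) (suc k)) (eλ-vanish 0 k ℕ.z≤n)

  D-eλλ : D (eλ λ') ≋ λ' · δ
  D-eλλ zero    = solve 1 (λ l → con 1ℤ :* (l :- con 0ℤ :* l) := l :* con 1ℤ) refl λ'
  D-eλλ (suc k) = trans (eλ-cong (sym (fromℕ-1-identityˡ λ')) (suc (suc k)))
                        (trans (eλ-vanish 1 (suc k) (ℕ.s≤s ℕ.z≤n)) (sym (zeroʳ λ')))

  θ-linComb : ∀ m w u → θ (linComb m w u) ≋ linComb m w (λ k → θ (u k))
  θ-linComb m w u n = begin
    ∑[ k ≤ m ] (u k (suc n) * w k) + ν * ∑[ k ≤ m ] (u k n * w k)          ≈⟨ +-congˡ (*-distribˡ-∑ m ν _) ⟩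
    ∑[ k ≤ m ] (u k (suc n) * w k) + ∑[ k ≤ m ] (ν * (u k n * w k))        ≈⟨ ∑-distrib-+ m _ _ ⟨
    ∑[ k ≤ m ] (u k (suc n) * w k + ν * (u k n * w k))                     ≈⟨ ∑-cong m (λ k →
        solve 4 (λ u₊ w ν u → u₊ :* w :+ ν :* (u :* w) := (u₊ :+ ν :* u) :* w) refl _ (w k) ν _) ⟩
    linComb m w (λ k → θ (u k)) n                                          ∎
    where
    open ≈-Reasoning
    ν = fromℕ n * λ'

  θ≋D⋆eλλ : ∀ a → θ a ≋ D a ⋆ eλ λ'
  θ≋D⋆eλλ a zero = sym (trans (⋆-head (D a) (eλ λ'))
    (solve 3 (λ a₁ l a₀ → a₁ :* con 1ℤ := a₁ :+ con 0ℤ :* l :* a₀) refl (a 1) λ' (a 0)))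
  θ≋D⋆eλλ a (suc n) = begin
    θ a (suc n)
      ≈⟨ solve 4 (λ a₂ ν l a₁ → a₂ :+ (con 1ℤ :+ ν) :* l :* a₁ := a₂ :+ ν :* l :* a₁ :+ l :* a₁)
           refl (a (suc (suc n))) (fromℕ n) λ' (a (suc n)) ⟩
    θ (D a) n + λ' * a (suc n)
      ≈⟨ +-cong (θ≋D⋆eλλ (D a) n) (sym (trans (⋆-scaleʳ λ' (D a) δ n) (*-congˡ (⋆-identityʳ (D a) n)))) ⟩
    (D (D a) ⋆ eλ λ') n + (D a ⋆ λ' · δ) n
      ≈⟨ +-congˡ (⋆-congʳ (D a) D-eλλ n) ⟨
    (D (D a) ⋆ eλ λ') n + (D a ⋆ D (eλ λ')) n
      ≈⟨ D-leibniz (D a) (eλ λ') n ⟨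
    D (D a ⋆ eλ λ') n
      ∎
    where open ≈-Reasoning

  θ-leibniz : ∀ a b → θ (a ⋆ b) ≋ θ a ⋆ b ⊞ a ⋆ θ b
  θ-leibniz a b = begin
    θ (a ⋆ b)                      ≈⟨ θ≋D⋆eλλ (a ⋆ b) ⟩
    D (a ⋆ b) ⋆ e                  ≈⟨ ⋆-congˡ e (D-leibniz a b) ⟩
    (D a ⋆ b ⊞ a ⋆ D b) ⋆ e        ≈⟨ ⋆-distribʳ (D a ⋆ b) (a ⋆ D b) e ⟩
    (D a ⋆ b) ⋆ e ⊞ (a ⋆ D b) ⋆ e  ≈⟨ ⊞-cong (⋆-swapʳ (D a) b e) (⋆-assoc a (D b) e) ⟩
    (D a ⋆ e) ⋆ b ⊞ a ⋆ (D b ⋆ e)  ≈⟨ ⊞-cong (⋆-congˡ b (θ≋D⋆eλλ a)) (⋆-congʳ a (θ≋D⋆eλλ b)) ⟨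
    θ a ⋆ b ⊞ a ⋆ θ b              ∎
    where
    open ≋-Reasoning
    e = eλ λ'

  θ-unique : ∀ s h {a b} → θ a ≋ s · a ⊞ h → θ b ≋ s · b ⊞ h → a 0 ≈ b 0 → a ≋ b
  θ-unique s h {a} {b} θa θb a₀≈b₀ zero    = a₀≈b₀
  θ-unique s h {a} {b} θa θb a₀≈b₀ (suc n) = begin
    a (suc n)                            ≈⟨ recover a ⟩
    θ a n - ν * a n                      ≈⟨ +-cong (θa n) (-‿cong (*-congˡ aₙ≈bₙ)) ⟩
    s * a n + h n - ν * b n              ≈⟨ +-congʳ (+-congʳ (*-congˡ aₙ≈bₙ)) ⟩
    s * b n + h n - ν * b n              ≈⟨ +-congʳ (θb n) ⟨
    θ b n - ν * b n                      ≈⟨ recover b ⟨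
    b (suc n)                            ∎
    where
    open ≈-Reasoning
    ν = fromℕ n * λ'
    aₙ≈bₙ = θ-unique s h θa θb a₀≈b₀ n
    recover : ∀ c → c (suc n) ≈ θ c n - ν * c n
    recover c = solve 2 (λ x y → x := x :+ y :- y) refl (c (suc n)) (ν * c n)

  eλ-+ : ∀ a b → eλ (a + b) ≋ eλ a ⋆ eλ b
  eλ-+ a b = θ-unique (a + b) 𝟘 θ-lhs θ-rhs (sym (trans (⋆-head (eλ a) (eλ b)) (*-identityˡ 1#)))
    where
    open ≋-Reasoning
    θ-lhs : θ (eλ (a + b)) ≋ (a + b) · eλ (a + b) ⊞ 𝟘
    θ-lhs n = trans (θ-eλ (a + b) n) (sym (+-identityʳ _))
    θ-rhs : θ (eλ a ⋆ eλ b) ≋ (a + b) · (eλ a ⋆ eλ b) ⊞ 𝟘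
    θ-rhs = begin
      θ (eλ a ⋆ eλ b)                              ≈⟨ θ-leibniz (eλ a) (eλ b) ⟩
      θ (eλ a) ⋆ eλ b ⊞ eλ a ⋆ θ (eλ b)            ≈⟨ ⊞-cong (⋆-congˡ (eλ b) (θ-eλ a)) (⋆-congʳ (eλ a) (θ-eλ b)) ⟩
      (a · eλ a) ⋆ eλ b ⊞ eλ a ⋆ (b · eλ b)        ≈⟨ ⊞-cong (⋆-scaleˡ a (eλ a) (eλ b)) (⋆-scaleʳ b (eλ a) (eλ b)) ⟩
      a · (eλ a ⋆ eλ b) ⊞ b · (eλ a ⋆ eλ b)        ≈⟨ (λ n → solve 3 (λ a b x → a :* x :+ b :* x := (a :+ b) :* x :+ con 0ℤ) refl a b _) ⟩
      (a + b) · (eλ a ⋆ eλ b) ⊞ 𝟘                  ∎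

module DegenerateBell {c ℓ : Level} (R : CommutativeRing c ℓ) (λ' : CommutativeRing.Carrier R) where
  open CommutativeRing R
  open Convolution R
  open FiniteSums R
  open DegenerateDerivative R λ'
  open IntegerCoefficients R using (solve; _:=_; _:+_; _:*_; _:-_; :-_; con)
  open import Algebra.Properties.CommutativeSemigroup (CommutativeMonoid.commutativeSemigroup ⋆-commutativeMonoid)
    using () renaming (x∙yz≈y∙xz to ⋆-swapˡ)

  column : ℕ → Seq
  column k n = S2 R λ' n k

  column⁻ : ℕ → Seq
  column⁻ zero    = 𝟘
  column⁻ (suc k) = column k

  S2-vanish : ∀ {n k} → n ℕ.< k → S2 R λ' n k ≈ 0#
  S2-vanish {zero}  {suc k} _            = refl
  S2-vanish {suc n} {suc k} (ℕ.s≤s n<k) =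
    trans (+-cong (S2-vanish n<k) (trans (*-congˡ (S2-vanish (ℕP.m<n⇒m<1+n n<k))) (zeroʳ _))) (+-identityʳ 0#)

  θ-column : ∀ k → θ (column k) ≋ fromℕ k · column k ⊞ column⁻ k
  θ-column zero n = solve 2 (λ ν s → (con 0ℤ :- ν) :* s :+ ν :* s := con 0ℤ :* s :+ con 0ℤ)
    refl (fromℕ n * λ') (S2 R λ' n 0)
  θ-column (suc k) n = solve 4 (λ s₋ κ ν s → s₋ :+ (κ :- ν) :* s :+ ν :* s := κ :* s :+ s₋)
    refl (S2 R λ' n k) (fromℕ (suc k)) (fromℕ n * λ') (S2 R λ' n (suc k))

  e : Seq
  e = eλ 1#

  -- column k is the EGF (e_λ(t) − 1)ᵏ/k!, and e_λ(t) = (e_λ(t) − 1) + 1.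
  e⋆column  : ∀ k → e ⋆ column k ≋ column k ⊞ fromℕ (suc k) · column (suc k)
  e⋆column⁻ : ∀ k → e ⋆ column⁻ k ≋ column⁻ k ⊞ fromℕ k · column k

  e⋆column⁻ zero    n = trans (⋆-comm e 𝟘 n) (trans (⋆-zeroˡ e n)
    (solve 1 (λ s → con 0ℤ := con 0ℤ :+ con 0ℤ :* s) refl (S2 R λ' n 0)))
  e⋆column⁻ (suc k) = e⋆column k

  e⋆column k = θ-unique (fromℕ (suc k)) h θ-lhs θ-rhs initial
    where
    open ≋-Reasoning
    κ = fromℕ k
    h = column⁻ k ⊞ κ · column k
    θ-lhs : θ (e ⋆ column k) ≋ fromℕ (suc k) · (e ⋆ column k) ⊞ h
    θ-lhs = begin
      θ (e ⋆ column k)                                  ≈⟨ θ-leibniz e (column k) ⟩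
      θ e ⋆ column k ⊞ e ⋆ θ (column k)                 ≈⟨ ⊞-cong (⋆-congˡ (column k) (θ-eλ 1#)) (⋆-congʳ e (θ-column k)) ⟩
      (1# · e) ⋆ column k ⊞ e ⋆ (κ · column k ⊞ column⁻ k)
        ≈⟨ ⊞-cong (⋆-scaleˡ 1# e (column k)) (≋-trans (⋆-distribˡ e (κ · column k) (column⁻ k)) (⊞-cong (⋆-scaleʳ κ e (column k)) (e⋆column⁻ k))) ⟩
      1# · (e ⋆ column k) ⊞ (κ · (e ⋆ column k) ⊞ h)
        ≈⟨ (λ n → solve 4 (λ x κ s₋ s → con 1ℤ :* x :+ (κ :* x :+ (s₋ :+ κ :* s)) := (con 1ℤ :+ κ) :* x :+ (s₋ :+ κ :* s))
                refl _ κ _ _) ⟩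
      fromℕ (suc k) · (e ⋆ column k) ⊞ h                ∎
    θ-rhs : θ (column k ⊞ fromℕ (suc k) · column (suc k)) ≋ fromℕ (suc k) · (column k ⊞ fromℕ (suc k) · column (suc k)) ⊞ h
    θ-rhs = begin
      θ (column k ⊞ fromℕ (suc k) · column (suc k))
        ≈⟨ ≋-trans (θ-⊞ _ _) (⊞-cong ≋-refl (θ-· _ _)) ⟩
      θ (column k) ⊞ fromℕ (suc k) · θ (column (suc k))
        ≈⟨ ⊞-cong (θ-column k) (·-congʳ _ (θ-column (suc k))) ⟩
      (κ · column k ⊞ column⁻ k) ⊞ fromℕ (suc k) · (fromℕ (suc k) · column (suc k) ⊞ column k)
        ≈⟨ (λ n → solve 4 (λ κ s₋ s s₊ → κ :* s :+ s₋ :+ (con 1ℤ :+ κ) :* ((con 1ℤ :+ κ) :* s₊ :+ s)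
                                       := (con 1ℤ :+ κ) :* (s :+ (con 1ℤ :+ κ) :* s₊) :+ (s₋ :+ κ :* s))
                refl κ _ _ _) ⟩
      fromℕ (suc k) · (column k ⊞ fromℕ (suc k) · column (suc k)) ⊞ h
        ∎
    initial : (e ⋆ column k) 0 ≈ S2 R λ' 0 k + fromℕ (suc k) * 0#
    initial = trans (⋆-head e (column k)) (solve 2 (λ s K → con 1ℤ :* s := s :+ K :* con 0ℤ) refl _ _)

  bell : Carrier → Seq
  bell y n = Bel R λ' n y

  bell-truncate : ∀ y {j N} → j ℕ.≤ N → bell y j ≈ linComb N (pow R y) column j
  bell-truncate y j≤N = sym (∑-extend _ j≤N (λ k j<k → trans (*-congʳ (S2-vanish j<k)) (zeroˡ _)))

  θ-bell : ∀ y → θ (bell y) ≋ y · (e ⋆ bell y)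
  θ-bell y n = begin
    θ (bell y) n
      ≈⟨ +-cong (bell-truncate y {suc n} ℕP.≤-refl) (*-congˡ (bell-truncate y (ℕP.n≤1+n n))) ⟩
    θ (linComb (suc n) (pow R y) column) n
      ≈⟨ θ-linComb (suc n) (pow R y) column n ⟩
    ∑[ k ≤ suc n ] (θ (column k) n * pow R y k)
      ≈⟨ ∑-cong (suc n) (λ k → *-congʳ (θ-column k n)) ⟩
    ∑[ k ≤ suc n ] ((fromℕ k * column k n + column⁻ k n) * pow R y k)
      ≈⟨ ∑-head n _ ⟩
    (0# * column 0 n + 0#) * 1# + ∑[ k ≤ n ] ((fromℕ (suc k) * column (suc k) n + column k n) * (pow R y k * y))
      ≈⟨ +-cong (solve 1 (λ s → (con 0ℤ :* s :+ con 0ℤ) :* con 1ℤ := con 0ℤ) refl _)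
                (∑-cong n (λ k → solve 5 (λ K s₊ s p y′ → (K :* s₊ :+ s) :* (p :* y′) := y′ :* ((s :+ K :* s₊) :* p))
                                         refl (fromℕ (suc k)) _ _ _ y)) ⟩
    0# + ∑[ k ≤ n ] (y * ((column k ⊞ fromℕ (suc k) · column (suc k)) n * pow R y k))
      ≈⟨ +-identityˡ _ ⟩
    ∑[ k ≤ n ] (y * ((column k ⊞ fromℕ (suc k) · column (suc k)) n * pow R y k))
      ≈⟨ ∑-cong n (λ k → *-congˡ (*-congʳ (e⋆column k n))) ⟨
    ∑[ k ≤ n ] (y * ((e ⋆ column k) n * pow R y k))
      ≈⟨ *-distribˡ-∑ n y _ ⟨
    y * linComb n (pow R y) (λ k → e ⋆ column k) n
      ≈⟨ *-congˡ (⋆-linComb e n (pow R y) column n) ⟨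
    y * (e ⋆ linComb n (pow R y) column) n
      ≈⟨ *-congˡ (⋆-cong-upto e n (λ j j≤n → bell-truncate y j≤n)) ⟨
    y * (e ⋆ bell y) n
      ∎
    where open ≈-Reasoning

  bell-inverse : ∀ x → bell x ⋆ bell (- x) ≋ δ
  bell-inverse x = θ-unique 0# 𝟘 θ-product θ-δ initial
    where
    B E : Seq
    B = bell x
    E = bell (- x)
    θ-product : θ (B ⋆ E) ≋ 0# · (B ⋆ E) ⊞ 𝟘
    θ-product = begin
      θ (B ⋆ E)                                   ≈⟨ θ-leibniz B E ⟩
      θ B ⋆ E ⊞ B ⋆ θ E                           ≈⟨ ⊞-cong (⋆-congˡ E (θ-bell x)) (⋆-congʳ B (θ-bell (- x))) ⟩
      (x · (e ⋆ B)) ⋆ E ⊞ B ⋆ ((- x) · (e ⋆ E))   ≈⟨ ⊞-cong (⋆-scaleˡ x (e ⋆ B) E) (⋆-scaleʳ (- x) B (e ⋆ E)) ⟩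
      x · ((e ⋆ B) ⋆ E) ⊞ (- x) · (B ⋆ (e ⋆ E))   ≈⟨ ⊞-cong (·-congʳ x (⋆-assoc e B E)) (·-congʳ (- x) (⋆-swapˡ B e E)) ⟩
      x · (e ⋆ (B ⋆ E)) ⊞ (- x) · (e ⋆ (B ⋆ E))   ≈⟨ (λ n → solve 3 (λ x u v → x :* u :+ (:- x) :* u := con 0ℤ :* v :+ con 0ℤ) refl x _ _) ⟩
      0# · (B ⋆ E) ⊞ 𝟘                            ∎
      where open ≋-Reasoning
    θ-δ : θ δ ≋ 0# · δ ⊞ 𝟘
    θ-δ zero    = solve 1 (λ l → con 0ℤ :+ con 0ℤ :* l :* con 1ℤ := con 0ℤ :* con 1ℤ :+ con 0ℤ) refl λ'
    θ-δ (suc n) = solve 1 (λ ν → con 0ℤ :+ ν :* con 0ℤ := con 0ℤ :* con 0ℤ :+ con 0ℤ) refl (fromℕ (suc n) * λ')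
    initial : (B ⋆ E) 0 ≈ 1#
    initial = trans (⋆-head B E) (solve 0 (con 1ℤ :* con 1ℤ :* (con 1ℤ :* con 1ℤ) := con 1ℤ) refl)

module StirlingBellIdentity {c ℓ : Level} (R : CommutativeRing c ℓ) (λ' x : CommutativeRing.Carrier R) where
  open CommutativeRing R
  open Convolution R
  open FiniteSums R
  open DegenerateDerivative R λ'
  open DegenerateBell R λ'
  open IntegerCoefficients R using (solve; _:=_; _:+_; _:*_; _:-_; :-_; con)
  open import Algebra.Properties.CommutativeSemigroup +-commutativeSemigroup using (x∙yz≈y∙xz)
  open import Algebra.Properties.CommutativeSemigroup *-commutativeSemigroup using () renaming (xy∙z≈y∙xz to *-xy∙z≈y∙xz)
  open import Algebra.Properties.CommutativeSemigroup (CommutativeMonoid.commutativeSemigroup ⋆-commutativeMonoid)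
    using () renaming (x∙yz≈y∙xz to ⋆-swapˡ)

  weight : ℕ → ℕ → Carrier
  weight m k = S2 R λ' m k * pow R x k

  linComb-weight-suc : ∀ m u → linComb (suc m) (weight (suc m)) u
    ≋ x · linComb m (weight m) (λ k → u (suc k)) ⊞ linComb m (weight m) (λ k → (fromℕ k - fromℕ m * λ') · u k)
  linComb-weight-suc m u n = begin
    linComb (suc m) (weight (suc m)) u n
      ≈⟨ ∑-head m _ ⟩
    u 0 n * weight (suc m) 0 + ∑[ k ≤ m ] (u (suc k) n * weight (suc m) (suc k))
      ≈⟨ +-cong first (∑-cong m split) ⟩
    v 0 + ∑[ k ≤ m ] (x * (u (suc k) n * weight m k) + v (suc k))
      ≈⟨ +-congˡ (∑-distrib-+ m _ _) ⟩
    v 0 + (∑[ k ≤ m ] (x * (u (suc k) n * weight m k)) + ∑[ k ≤ m ] v (suc k))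
      ≈⟨ x∙yz≈y∙xz _ _ _ ⟩
    ∑[ k ≤ m ] (x * (u (suc k) n * weight m k)) + (v 0 + ∑[ k ≤ m ] v (suc k))
      ≈⟨ +-cong (*-distribˡ-∑ m x _) (∑-head m v) ⟨
    x * linComb m (weight m) (λ k → u (suc k)) n + (∑ m v + v (suc m))
      ≈⟨ +-congˡ (trans (+-congˡ last) (+-identityʳ _)) ⟩
    x * linComb m (weight m) (λ k → u (suc k)) n + ∑ m v
      ∎
    where
    open ≈-Reasoning
    μ = fromℕ m * λ'
    v : ℕ → Carrier
    v k = (fromℕ k - μ) * u k n * weight m k
    first : u 0 n * weight (suc m) 0 ≈ v 0
    first = solve 4 (λ u μ s p → u :* ((con 0ℤ :- μ) :* s :* p) := (con 0ℤ :- μ) :* u :* (s :* p)) refl _ μ _ _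
    split : ∀ k → u (suc k) n * weight (suc m) (suc k) ≈ x * (u (suc k) n * weight m k) + v (suc k)
    split k = solve 7 (λ u s K μ s₊ p x → u :* ((s :+ (K :- μ) :* s₊) :* (p :* x)) := x :* (u :* (s :* p)) :+ (K :- μ) :* u :* (s₊ :* (p :* x)))
      refl _ _ (fromℕ (suc k)) μ _ _ x
    last : v (suc m) ≈ 0#
    last = trans (*-congˡ (trans (*-congʳ (S2-vanish (ℕP.n<1+n m))) (zeroˡ _))) (zeroʳ _)

  step : ℕ → Seq → Seq
  step m a = x · (e ⋆ a) ⊞ (θ a ⊞ (- (fromℕ m * λ')) · a)

  step-cong : ∀ m {a b} → a ≋ b → step m a ≋ step m b
  step-cong m a≋b = ⊞-cong (·-congʳ x (⋆-congʳ e a≋b)) (⊞-cong (θ-cong a≋b) (·-congʳ _ a≋b))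

  lhs : ℕ → Seq
  lhs m n = ∑[ k ≤ m ] (S2 R λ' m k * eλ (fromℕ k) n * pow R x k)

  lhs-linComb : ∀ m → lhs m ≋ linComb m (weight m) (λ k → eλ (fromℕ k))
  lhs-linComb m n = ∑-cong m (λ k → *-xy∙z≈y∙xz _ _ _)

  lhs-zero : lhs 0 ≋ δ
  lhs-zero n = trans (*-identityʳ _) (trans (*-identityˡ _) (eλ-zero n))

  lhs-suc : ∀ m → lhs (suc m) ≋ step m (lhs m)
  lhs-suc m = begin
    lhs (suc m)
      ≈⟨ lhs-linComb (suc m) ⟩
    linComb (suc m) (weight (suc m)) u
      ≈⟨ linComb-weight-suc m u ⟩
    x · linComb m w (λ k → u (suc k)) ⊞ linComb m w (λ k → (fromℕ k - μ) · u k)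
      ≈⟨ ⊞-cong (·-congʳ x (linComb-cong m w (λ k → eλ-+ 1# (fromℕ k)))) (linComb-cong m w shift) ⟩
    x · linComb m w (λ k → e ⋆ u k) ⊞ linComb m w (λ k → θ (u k) ⊞ (- μ) · u k)
      ≈⟨ ⊞-cong ≋-refl (linComb-⊞ m w _ _) ⟩
    x · linComb m w (λ k → e ⋆ u k) ⊞ (linComb m w (λ k → θ (u k)) ⊞ linComb m w (λ k → (- μ) · u k))
      ≈⟨ ⊞-cong (·-congʳ x (⋆-linComb e m w u)) (⊞-cong (θ-linComb m w u) (≋-sym (linComb-· m w (- μ) u))) ⟨
    step m (linComb m w u)
      ≈⟨ step-cong m (lhs-linComb m) ⟨
    step m (lhs m)
      ∎
    where
    open ≋-Reasoning
    μ = fromℕ m * λ'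
    w = weight m
    u : ℕ → Seq
    u k = eλ (fromℕ k)
    shift : ∀ k → (fromℕ k - μ) · u k ≋ θ (u k) ⊞ (- μ) · u k
    shift k n = trans (solve 3 (λ κ μ a → (κ :- μ) :* a := κ :* a :+ (:- μ) :* a) refl (fromℕ k) μ (u k n))
                      (+-congʳ (sym (θ-eλ (fromℕ k) n)))

  shiftedBell : ℕ → Seq
  shiftedBell m k = bell x (m ℕ.+ k)

  eλ-mλ : ℕ → Seq
  eλ-mλ m = eλ (fromℕ m * λ')

  rhs : ℕ → Seq
  rhs m = shiftedBell m ⋆ (eλ-mλ m ⋆ bell (- x))

  θ-shiftedBell : ∀ m → θ (shiftedBell m) ≋ shiftedBell (suc m) ⋆ eλ λ'
  θ-shiftedBell m = ≋-trans (θ≋D⋆eλλ (shiftedBell m))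
    (⋆-congˡ (eλ λ') (λ k → reflexive (P.cong (bell x) (ℕP.+-suc m k))))

  eλ-mλ-suc : ∀ m → eλ-mλ (suc m) ≋ eλ λ' ⋆ eλ-mλ m
  eλ-mλ-suc m = ≋-trans (eλ-cong (solve 2 (λ κ l → (con 1ℤ :+ κ) :* l := l :+ κ :* l) refl (fromℕ m) λ'))
                              (eλ-+ λ' (fromℕ m * λ'))

  rhs-zero : rhs 0 ≋ δ
  rhs-zero = begin
    bell x ⋆ (eλ (0# * λ') ⋆ bell (- x))   ≈⟨ ⋆-congʳ (bell x) (⋆-congˡ (bell (- x)) (≋-trans (eλ-cong (zeroˡ λ')) eλ-zero)) ⟩
    bell x ⋆ (δ ⋆ bell (- x))              ≈⟨ ⋆-congʳ (bell x) (⋆-identityˡ (bell (- x))) ⟩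
    bell x ⋆ bell (- x)                    ≈⟨ bell-inverse x ⟩
    δ                                      ∎
    where open ≋-Reasoning

  θ-rhs : ∀ m → θ (rhs m) ≋ rhs (suc m) ⊞ (fromℕ m * λ') · rhs m ⊞ (- x) · (e ⋆ rhs m)
  θ-rhs m = begin
    θ (A ⋆ (P ⋆ E))                                    ≈⟨ θ-leibniz A (P ⋆ E) ⟩
    θ A ⋆ (P ⋆ E) ⊞ A ⋆ θ (P ⋆ E)                      ≈⟨ ⊞-cong ≋-refl (≋-trans (⋆-congʳ A (θ-leibniz P E)) (⋆-distribˡ A (θ P ⋆ E) (P ⋆ θ E))) ⟩
    θ A ⋆ (P ⋆ E) ⊞ (A ⋆ (θ P ⋆ E) ⊞ A ⋆ (P ⋆ θ E))    ≈⟨ ⊞-cong first (⊞-cong second third) ⟩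
    rhs (suc m) ⊞ (μ · rhs m ⊞ (- x) · (e ⋆ rhs m))    ≈⟨ (λ n → sym (+-assoc _ _ _)) ⟩
    rhs (suc m) ⊞ μ · rhs m ⊞ (- x) · (e ⋆ rhs m)      ∎
    where
    open ≋-Reasoning
    μ = fromℕ m * λ'
    A = shiftedBell m
    P = eλ-mλ m
    E = bell (- x)
    first : θ A ⋆ (P ⋆ E) ≋ rhs (suc m)
    first = begin
      θ A ⋆ (P ⋆ E)                            ≈⟨ ⋆-congˡ (P ⋆ E) (θ-shiftedBell m) ⟩
      (shiftedBell (suc m) ⋆ eλ λ') ⋆ (P ⋆ E)  ≈⟨ ⋆-assoc (shiftedBell (suc m)) (eλ λ') (P ⋆ E) ⟩
      shiftedBell (suc m) ⋆ (eλ λ' ⋆ (P ⋆ E))  ≈⟨ ⋆-congʳ (shiftedBell (suc m)) (⋆-assoc (eλ λ') P E) ⟨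
      shiftedBell (suc m) ⋆ ((eλ λ' ⋆ P) ⋆ E)  ≈⟨ ⋆-congʳ (shiftedBell (suc m)) (⋆-congˡ E (eλ-mλ-suc m)) ⟨
      rhs (suc m)                              ∎
    second : A ⋆ (θ P ⋆ E) ≋ μ · rhs m
    second = begin
      A ⋆ (θ P ⋆ E)          ≈⟨ ⋆-congʳ A (⋆-congˡ E (θ-eλ μ)) ⟩
      A ⋆ ((μ · P) ⋆ E)      ≈⟨ ⋆-congʳ A (⋆-scaleˡ μ P E) ⟩
      A ⋆ (μ · (P ⋆ E))      ≈⟨ ⋆-scaleʳ μ A (P ⋆ E) ⟩
      μ · rhs m              ∎
    third : A ⋆ (P ⋆ θ E) ≋ (- x) · (e ⋆ rhs m)
    third = begin
      A ⋆ (P ⋆ θ E)                  ≈⟨ ⋆-congʳ A (⋆-congʳ P (θ-bell (- x))) ⟩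
      A ⋆ (P ⋆ ((- x) · (e ⋆ E)))    ≈⟨ ⋆-congʳ A (⋆-scaleʳ (- x) P (e ⋆ E)) ⟩
      A ⋆ ((- x) · (P ⋆ (e ⋆ E)))    ≈⟨ ⋆-scaleʳ (- x) A (P ⋆ (e ⋆ E)) ⟩
      (- x) · (A ⋆ (P ⋆ (e ⋆ E)))    ≈⟨ ·-congʳ (- x) (≋-trans (⋆-congʳ A (⋆-swapˡ P e E)) (⋆-swapˡ A e (P ⋆ E))) ⟩
      (- x) · (e ⋆ rhs m)            ∎

  rhs-suc : ∀ m → rhs (suc m) ≋ step m (rhs m)
  rhs-suc m n = begin
    rhs (suc m) n
      ≈⟨ solve 5 (λ q′ x μ u q → q′ := x :* u :+ ((q′ :+ μ :* q :+ (:- x) :* u) :+ (:- μ) :* q)) refl _ x (fromℕ m * λ') _ _ ⟩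
    x * (e ⋆ rhs m) n + ((rhs (suc m) ⊞ (fromℕ m * λ') · rhs m ⊞ (- x) · (e ⋆ rhs m)) n + (- (fromℕ m * λ')) * rhs m n)
      ≈⟨ +-congˡ (+-congʳ (θ-rhs m n)) ⟨
    step m (rhs m) n
      ∎
    where open ≈-Reasoning

  lhs≋rhs : ∀ m → lhs m ≋ rhs m
  lhs≋rhs zero    = ≋-trans lhs-zero (≋-sym rhs-zero)
  lhs≋rhs (suc m) = ≋-trans (lhs-suc m) (≋-trans (step-cong m (lhs≋rhs m)) (≋-sym (rhs-suc m)))

  rhs-expand : ∀ m n → rhs m n ≈ ∑[ k ≤ n ] ∑[ j ≤ n ∸ k ]
    (binom R n k * binom R (n ∸ k) j * Bel R λ' (m ℕ.+ k) x * Bel R λ' (n ∸ k ∸ j) (- x) * dfall R λ' (fromℕ m * λ') j)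
  rhs-expand m n = ∑-cong n (λ k → trans (*-distribˡ-∑ (n ∸ k) _ _) (∑-cong (n ∸ k) (λ j →
    solve 5 (λ β a β′ p b → β :* a :* (β′ :* p :* b) := β :* β′ :* a :* b :* p) refl _ _ _ _ _)))

open import Data.Nat using (_+_)

theorem13 : ∀ {c ℓ : Level} (R : CommutativeRing c ℓ) →
    let open CommutativeRing R renaming (_+_ to _⊕_) in
    ∀ (λ' : Carrier) (m n : ℕ) (x : Carrier) →
      sumTo R m (λ k → S2 R λ' m k * dfall R λ' (⟦_⟧ R k) n * pow R x k)
      ≈ sumTo R n (λ k → sumTo R (n ∸ k) (λ j →
          binom R n k * binom R (n ∸ k) j * Bel R λ' (m + k) x
          * Bel R λ' (n ∸ k ∸ j) (- x) * dfall R λ' (⟦_⟧ R m * λ') j))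
theorem13 R λ' m n x = CommutativeRing.trans R (lhs≋rhs m n) (rhs-expand m n)
  where open StirlingBellIdentity R λ' x
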